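{- Let $\mathbf{d}=(d_1,\ldots,d_n)$ be an arranged sequence of positive integers (not assumed graphic), and let $\mathbf{k},\mathbf{k}'\in\{0,1\}^n$. If $\mathbf{d}-\mathbf{k}$ is graphic and $A(\mathbf{k}')\preceq A(\mathbf{k})$, then $\mathbf{d}-\mathbf{k}'$ is graphic.
   Context: A finite sequence of nonnegative integers is graphic if it is the degree sequence of some simple graph (with a vertex labelling). A sequence is arranged if $d_1\ge\cdots\ge d_n$. For $\mathbf{k}=(k_1,\ldots,k_n)\in\{0,1\}^n$, the support set $A(\mathbf{k})$ is the set of indices $i\in\{1,\ldots,n\}$ with $k_i=1$, and $\mathbf{d}-\mathbf{k}$ is the coordinatewise difference. For two such supports, $A(\mathbf{k}_1)\preceq A(\mathbf{k}_2)$ means $|A(\mathbf{k}_1)|=|A(\mathbf{k}_2)|=s$ and, writing $A(\mathbf{k}_1)=\{a_1<\cdots<a_s\}$ and $A(\mathbf{k}_2)=\{b_1<\cdots<b_s\}$, one has $a_j\le b_j$ for all $j$ (i.e., $A(\mathbf{k}_1)$ is obtained from $A(\mathbf{k}_2)$ by left-shifting). -}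

module Defs where

open import Data.Nat using (ℕ; _≤_; _<_; _∸_)
open import Data.Bool using (Bool; true; false; if_then_else_)
open import Data.Fin using (Fin; toℕ)
open import Data.List using (List; map; filter; allFin)
open import Data.Nat.ListAction using (sum)
open import Data.List.Relation.Binary.Pointwise using (Pointwise)
open import Data.Product using (Σ; _×_)
open import Relation.Binary.PropositionalEquality using (_≡_)
open import Data.Bool.Properties using () renaming (T? to T?)
open import Data.Bool using (T)

-- A sequence of length n, indexed by Fin n (index i ↔ position toℕ i + 1).
Seq : ℕ → Set
Seq n = Fin n → ℕ

Bin : ℕ → Set
Bin n = Fin n → Bool

bit : Bool → ℕ
bit true  = 1
bit false = 0

_-ᵏ_ : ∀ {n} → Seq n → Bin n → Seq n
(d -ᵏ k) i = d i ∸ bit (k i)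

Arranged : ∀ {n} → Seq n → Set
Arranged {n} d = ∀ (i j : Fin n) → toℕ i ≤ toℕ j → d j ≤ d i

Positive : ∀ {n} → Seq n → Set
Positive {n} d = ∀ (i : Fin n) → 0 < d i

record SimpleGraph (n : ℕ) : Set where
  field
    adj   : Fin n → Fin n → Bool
    sym   : ∀ i j → adj i j ≡ adj j i
    irrefl : ∀ i → adj i i ≡ false

degree : ∀ {n} → SimpleGraph n → Fin n → ℕ
degree {n} G i = sum (map (λ j → bit (SimpleGraph.adj G i j)) (allFin n))

Graphic : ∀ {n} → Seq n → Set
Graphic {n} d = Σ (SimpleGraph n) (λ G → ∀ i → degree G i ≡ d i)

-- Support A(k), listed in increasing order.
support : ∀ {n} → Bin n → List (Fin n)
support {n} k = filter (λ i → T? (k i)) (allFin n)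

-- A(k₁) ⪯ A(k₂): same size s and a_j ≤ b_j for all j
-- (Pointwise forces equal lengths).
_⪯_ : ∀ {n} → List (Fin n) → List (Fin n) → Set
A ⪯ B = Pointwise (λ a b → toℕ a ≤ toℕ b) A B

-- Since d_a ≥ d_b, a realisation of d − k in which b has lost a unit
-- of degree and a has not gives deg a > deg b, so some neighbour w of a
-- is not a neighbour of b; switching the edge aw to bw realises the
-- sequence in which a, instead of b, has lost the unit.  If
-- A(k′) = {a₁ < ⋯ < aₛ} ⪯ A(k) = {b₁ < ⋯ < bₛ}, shifting b₁ to a₁, then
-- b₂ to a₂, and so on, turns d − k into d − k′ through graphic sequences:
-- since aⱼ ≤ bⱼ < bⱼ₊₁ < ⋯ and a₁ < ⋯ < aⱼ₋₁ < aⱼ, every shift moves a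
-- unit between two positions not otherwise reduced.
module Submission where

open import Defs
open import Data.Nat using (ℕ; zero; suc; _+_; _∸_; _≤_; _<_; z≤n; s≤s; >-nonZero)
open import Data.Nat.Properties hiding (_≟_)
open import Data.Bool using (Bool; true; false; not; _∧_; _∨_; _xor_)
import Data.Bool.Properties as Bool
open import Data.Fin as Fin using (Fin; zero; suc)
open import Data.Fin.Properties as Fin using (_≟_; any?)
open import Data.List using (List; []; _∷_; tabulate; allFin)
open import Data.Nat.ListAction using (sum)
open import Data.List.Properties using (map-tabulate; map-cong)
open import Data.List.Relation.Binary.Pointwise using ([]; _∷_)
open import Data.List.Relation.Unary.All as All using (All; []; _∷_)
open import Data.List.Relation.Unary.All.Properties using (All¬⇒¬Any)
open import Data.List.Relation.Unary.AllPairs using (AllPairs; []; _∷_)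
import Data.List.Relation.Unary.AllPairs.Properties as AllPairs
open import Data.List.Membership.Propositional using (_∉_)
open import Data.List.Membership.Propositional.Properties using (∈-filter⁺; ∈-filter⁻; ∈-allFin)
import Data.List.Relation.Unary.Any as Any
open import Data.Product using (∃; _×_; _,_; proj₂)
open import Function using (id; const; _∘_; mk⇔)
open import Data.Vec.Functional using (updateAt)
open import Data.Vec.Functional.Properties using (updateAt-updates; updateAt-minimal)
open import Relation.Nullary using (Dec; does; yes; no; ¬?; contradiction)
open import Relation.Nullary.Decidable using (_×-dec_; dec-true; dec-false; does-⇔)
open import Relation.Binary.PropositionalEquality
open import Algebra.Bundles using (CommutativeMonoid)
open import Algebra.Properties.CommutativeSemigroup +-commutativeSemigroup
  using (xy∙z≈zy∙x; xy∙z≈xz∙y)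
open import Algebra.Properties.CommutativeSemigroup
  (CommutativeMonoid.commutativeSemigroup Bool.∨-commutativeMonoid)
  using () renaming (x∙yz≈y∙xz to ∨-swap)

private
  variable
    n : ℕ
    f g : Fin n → ℕ

∑ : (Fin n → ℕ) → ℕ
∑ f = sum (tabulate f)

∑-mono-≤ : (∀ i → f i ≤ g i) → ∑ f ≤ ∑ g
∑-mono-≤ {zero}  f≤g = z≤n
∑-mono-≤ {suc n} f≤g = +-mono-≤ (f≤g zero) (∑-mono-≤ (f≤g ∘ suc))

∑-mono-≤-except : (x : Fin n) → (∀ j → j ≢ x → f j ≤ g j) →
  ∑ f + g x ≤ ∑ g + f x
∑-mono-≤-except {f = f} {g} zero f≤g = begin
  f zero + ∑ (f ∘ suc) + g zero ≡⟨ xy∙z≈zy∙x (f zero) _ (g zero) ⟩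
  g zero + ∑ (f ∘ suc) + f zero ≤⟨ +-monoˡ-≤ (f zero) (+-monoʳ-≤ (g zero) (∑-mono-≤ λ j → f≤g (suc j) λ ())) ⟩
  g zero + ∑ (g ∘ suc) + f zero ∎
  where open ≤-Reasoning
∑-mono-≤-except {f = f} {g} (suc x) f≤g = begin
  f zero + ∑ (f ∘ suc) + g (suc x)   ≡⟨ +-assoc (f zero) _ _ ⟩
  f zero + (∑ (f ∘ suc) + g (suc x)) ≤⟨ +-mono-≤ (f≤g zero λ ()) (∑-mono-≤-except x f≤g-off-x) ⟩
  g zero + (∑ (g ∘ suc) + f (suc x)) ≡⟨ +-assoc (g zero) _ _ ⟨
  g zero + ∑ (g ∘ suc) + f (suc x)   ∎
  where
  open ≤-Reasoning
  f≤g-off-x : ∀ j → j ≢ x → f (suc j) ≤ g (suc j)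
  f≤g-off-x j j≢x = f≤g (suc j) (j≢x ∘ Fin.suc-injective)

∑-update : (x : Fin n) → (∀ j → j ≢ x → f j ≡ g j) → ∑ f + g x ≡ ∑ g + f x
∑-update x f≡g = ≤-antisym
  (∑-mono-≤-except x λ j j≢x → ≤-reflexive (f≡g j j≢x))
  (∑-mono-≤-except x λ j j≢x → ≤-reflexive (sym (f≡g j j≢x)))

∑-mono-≤-except₂ : {x y : Fin n} → x ≢ y → (∀ j → j ≢ x → j ≢ y → f j ≤ g j) →
  ∑ f + g x + g y ≤ ∑ g + f x + f y
∑-mono-≤-except₂ {f = f} {g} {x} {y} x≢y f≤g = begin
  ∑ f + g x + g y ≡⟨ cong (λ t → ∑ f + t + g y) (updateAt-updates x f) ⟨
  ∑ f + h x + g y ≤⟨ +-monoˡ-≤ (g y) (∑-mono-≤-except x λ j j≢x → ≤-reflexive (sym (h-off-x j j≢x))) ⟩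
  ∑ h + f x + g y ≡⟨ xy∙z≈xz∙y (∑ h) (f x) (g y) ⟩
  ∑ h + g y + f x ≤⟨ +-monoˡ-≤ (f x) (∑-mono-≤-except y h≤g) ⟩
  ∑ g + h y + f x ≡⟨ xy∙z≈xz∙y (∑ g) (h y) (f x) ⟩
  ∑ g + f x + h y ≡⟨ cong (∑ g + f x +_) (h-off-x y (x≢y ∘ sym)) ⟩
  ∑ g + f x + f y ∎
  where
  open ≤-Reasoning
  h : Fin _ → ℕ
  h = updateAt f x (const (g x))
  h-off-x : ∀ j → j ≢ x → h j ≡ f j
  h-off-x j j≢x = updateAt-minimal j x f j≢x
  h≤g : ∀ j → j ≢ y → h j ≤ g j
  h≤g j j≢y with j ≟ x
  ... | yes refl = ≤-reflexive (updateAt-updates x f)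
  ... | no j≢x   = ≤-trans (≤-reflexive (h-off-x j j≢x)) (f≤g j j≢x j≢y)

open SimpleGraph using (adj; irrefl) renaming (sym to adj-sym)

row : SimpleGraph n → Fin n → Fin n → ℕ
row G i j = bit (adj G i j)

degree-∑ : (G : SimpleGraph n) (i : Fin n) → degree G i ≡ ∑ (row G i)
degree-∑ G i = cong sum (map-tabulate id (row G i))

row-irrefl : (G : SimpleGraph n) (i : Fin n) → row G i i ≡ 0
row-irrefl G i = cong bit (irrefl G i)

-- Otherwise every neighbour of u other than v is a neighbour of v, and
-- counting the edge uv on both sides gives degree u ≤ degree v.
exclusive-neighbour : (G : SimpleGraph n) {u v : Fin n} → degree G v < degree G u →
  ∃ λ w → adj G u w ≡ true × adj G v w ≡ false × w ≢ v
exclusive-neighbour G {u} {v} dv<du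
  with any? (λ w → (adj G u w Bool.≟ true) ×-dec (adj G v w Bool.≟ false) ×-dec ¬? (w ≟ v))
... | yes found = found
... | no none = contradiction du≤dv (<⇒≱ dv<du)
  where
  u≢v : u ≢ v
  u≢v refl = <-irrefl refl dv<du

  covered : ∀ j → j ≢ u → j ≢ v → row G u j ≤ row G v j
  covered j _ j≢v with adj G u j in uj | adj G v j in vj
  ... | false | _     = z≤n
  ... | true  | true  = s≤s z≤n
  ... | true  | false = contradiction (j , uj , vj , j≢v) none

  du≤dv : degree G u ≤ degree G v
  du≤dv = +-cancelʳ-≤ (row G u v) _ _ (begin
    degree G u + row G u v              ≡⟨ cong₂ _+_ (degree-∑ G u) (cong bit (adj-sym G u v)) ⟩
    ∑ (row G u) + row G v u             ≡⟨ +-identityʳ _ ⟨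
    ∑ (row G u) + row G v u + 0         ≡⟨ cong (∑ (row G u) + row G v u +_) (row-irrefl G v) ⟨
    ∑ (row G u) + row G v u + row G v v ≤⟨ ∑-mono-≤-except₂ u≢v covered ⟩
    ∑ (row G v) + row G u u + row G u v ≡⟨ cong (λ r → ∑ (row G v) + r + row G u v) (row-irrefl G u) ⟩
    ∑ (row G v) + 0 + row G u v         ≡⟨ cong (_+ row G u v) (+-identityʳ (∑ (row G v))) ⟩
    ∑ (row G v) + row G u v             ≡⟨ cong (_+ row G u v) (degree-∑ G v) ⟨
    degree G v + row G u v              ∎)
    where open ≤-Reasoning

connects : (x y i j : Fin n) → Bool
connects x y i j = does (i ≟ x) ∧ does (j ≟ y) ∨ does (i ≟ y) ∧ does (j ≟ x)

connects-sym : (x y i j : Fin n) → connects x y i j ≡ connects x y j i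
connects-sym x y i j = trans (Bool.∨-comm (does (i ≟ x) ∧ does (j ≟ y)) _)
  (cong₂ _∨_ (Bool.∧-comm (does (i ≟ y)) (does (j ≟ x))) (Bool.∧-comm (does (i ≟ x)) (does (j ≟ y))))

connects-irrefl : {x y : Fin n} → x ≢ y → (i : Fin n) → connects x y i i ≡ false
connects-irrefl {x = x} {y} x≢y i with i ≟ x | i ≟ y
... | yes refl | yes refl = contradiction refl x≢y
... | yes _    | no _     = refl
... | no _     | yes _    = refl
... | no _     | no _     = refl

connects-source : {x y : Fin n} → x ≢ y → (j : Fin n) → connects x y x j ≡ does (j ≟ y)
connects-source {x = x} {y} x≢y j
  rewrite dec-true (x ≟ x) refl | dec-false (x ≟ y) x≢y = Bool.∨-identityʳ (does (j ≟ y))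

connects-target : {x y : Fin n} → x ≢ y → (j : Fin n) → connects x y y j ≡ does (j ≟ x)
connects-target {x = x} {y} x≢y j
  rewrite dec-false (y ≟ x) (x≢y ∘ sym) | dec-true (y ≟ y) refl = refl

connects-outside : {x y i : Fin n} → i ≢ x → i ≢ y → (j : Fin n) → connects x y i j ≡ false
connects-outside {x = x} {y} {i} i≢x i≢y j
  rewrite dec-false (i ≟ x) i≢x | dec-false (i ≟ y) i≢y = refl

toggle : (x y : Fin n) → x ≢ y → SimpleGraph n → SimpleGraph n
toggle x y x≢y G = record
  { adj    = λ i j → connects x y i j xor adj G i j
  ; sym    = λ i j → cong₂ _xor_ (connects-sym x y i j) (adj-sym G i j)
  ; irrefl = λ i → cong₂ _xor_ (connects-irrefl x≢y i) (irrefl G i)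
  }

module _ (G : SimpleGraph n) {x y : Fin n} (x≢y : x ≢ y) where

  private
    G′ : SimpleGraph n
    G′ = toggle x y x≢y G

  degree-toggle-outside : {i : Fin n} → i ≢ x → i ≢ y → degree G′ i ≡ degree G i
  degree-toggle-outside i≢x i≢y = cong sum (map-cong
    (λ j → cong (λ c → bit (c xor adj G _ j)) (connects-outside i≢x i≢y j)) (allFin n))

  degree-toggle-endpoint : (i o : Fin n) → (∀ j → connects x y i j ≡ does (j ≟ o)) →
    {b : Bool} → adj G i o ≡ b → degree G′ i + bit b ≡ degree G i + bit (not b)
  degree-toggle-endpoint i o at-i refl = begin
    degree G′ i + row G i o  ≡⟨ cong (_+ row G i o) (degree-∑ G′ i) ⟩
    ∑ (row G′ i) + row G i o ≡⟨ ∑-update o unchanged ⟩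
    ∑ (row G i) + row G′ i o ≡⟨ cong₂ _+_ (degree-∑ G i) toggled ⟨
    degree G i + bit (not (adj G i o)) ∎
    where
    open ≡-Reasoning
    unchanged : ∀ j → j ≢ o → row G′ i j ≡ row G i j
    unchanged j j≢o = cong (λ c → bit (c xor adj G i j)) (trans (at-i j) (dec-false (j ≟ o) j≢o))
    toggled : bit (not (adj G i o)) ≡ row G′ i o
    toggled = cong (λ c → bit (c xor adj G i o)) (sym (trans (at-i o) (dec-true (o ≟ o) refl)))

  degree-toggle-edge : (i o : Fin n) → (∀ j → connects x y i j ≡ does (j ≟ o)) →
    adj G i o ≡ true → suc (degree G′ i) ≡ degree G i
  degree-toggle-edge i o at-i io =
    trans (+-comm 1 _) (trans (degree-toggle-endpoint i o at-i io) (+-identityʳ _))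

  degree-toggle-non-edge : (i o : Fin n) → (∀ j → connects x y i j ≡ does (j ≟ o)) →
    adj G i o ≡ false → degree G′ i ≡ suc (degree G i)
  degree-toggle-non-edge i o at-i io =
    trans (sym (+-identityʳ _)) (trans (degree-toggle-endpoint i o at-i io) (+-comm _ 1))

record Transfer (u v : Fin n) (d d′ : Seq n) : Set where
  field
    source : suc (d′ u) ≡ d u
    target : d′ v ≡ suc (d v)
    others : ∀ x → x ≢ u → x ≢ v → d′ x ≡ d x

private module T = Transfer

transfer-unique : {u v : Fin n} {d e d′ e′ : Seq n} → d ≗ e →
  Transfer u v d d′ → Transfer u v e e′ → d′ ≗ e′
transfer-unique {u = u} {v} d≗e t t′ x with x ≟ u | x ≟ v
... | yes refl | _        = suc-injective (trans (T.source t) (trans (d≗e x) (sym (T.source t′))))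
... | no _     | yes refl = trans (T.target t) (trans (cong suc (d≗e x)) (sym (T.target t′)))
... | no x≢u   | no x≢v   = trans (T.others t x x≢u x≢v) (trans (d≗e x) (sym (T.others t′ x x≢u x≢v)))

edge-switch : (G : SimpleGraph n) {u v : Fin n} → degree G v < degree G u →
  ∃ λ G′ → Transfer u v (degree G) (degree G′)
edge-switch G {u} {v} dv<du with exclusive-neighbour G dv<du
... | w , uw , vw , w≢v = G₂ , record { source = source ; target = target ; others = others }
  where
  u≢v : u ≢ v
  u≢v refl = <-irrefl refl dv<du
  u≢w : u ≢ w
  u≢w refl = contradiction (trans (sym uw) (irrefl G u)) λ ()
  v≢w : v ≢ w
  v≢w = w≢v ∘ sym

  G₁ G₂ : SimpleGraph _
  G₁ = toggle u w u≢w G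
  G₂ = toggle v w v≢w G₁

  v₁w : adj G₁ v w ≡ false
  v₁w = trans (cong (_xor adj G v w) (connects-outside (u≢v ∘ sym) v≢w w)) vw

  source : suc (degree G₂ u) ≡ degree G u
  source = trans (cong suc (degree-toggle-outside G₁ v≢w u≢v u≢w))
    (degree-toggle-edge G u≢w u w (connects-source u≢w) uw)
  target : degree G₂ v ≡ suc (degree G v)
  target = trans (degree-toggle-non-edge G₁ v≢w v w (connects-source v≢w) v₁w)
    (cong suc (degree-toggle-outside G u≢w (u≢v ∘ sym) v≢w))
  others : ∀ x → x ≢ u → x ≢ v → degree G₂ x ≡ degree G x
  others x x≢u x≢v = by-cases (x ≟ w)
    where
    by-cases : Dec (x ≡ w) → degree G₂ x ≡ degree G x
    by-cases (yes refl) = trans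
      (degree-toggle-non-edge G₁ v≢w w v (connects-target v≢w) (trans (adj-sym G₁ x v) v₁w))
      (degree-toggle-edge G u≢w w u (connects-target u≢w) (trans (adj-sym G x u) uw))
    by-cases (no x≢w) =
      trans (degree-toggle-outside G₁ v≢w x≢v x≢w) (degree-toggle-outside G u≢w x≢u x≢w)

graphic-transfer : {u v : Fin n} {d d′ : Seq n} →
  Graphic d → d v < d u → Transfer u v d d′ → Graphic d′
graphic-transfer {u = u} {v} (G , G≗d) dv<du t
  with edge-switch G (subst₂ _<_ (sym (G≗d v)) (sym (G≗d u)) dv<du)
... | G′ , t′ = G′ , transfer-unique G≗d t′ t

graphic-resp : {d d′ : Seq n} → d ≗ d′ → Graphic d → Graphic d′
graphic-resp d≗d′ (G , G≗d) = G , λ i → trans (G≗d i) (d≗d′ i)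

insert : Fin n → Bin n → Bin n
insert x k i = does (i ≟ x) ∨ k i

_∪_ : Bin n → Bin n → Bin n
(k ∪ k′) i = k i ∨ k′ i

indicator : List (Fin n) → Bin n
indicator L i = does (Any.any? (i ≟_) L)

Increasing : List (Fin n) → Set
Increasing = AllPairs Fin._<_

Disjoint : Bin n → List (Fin n) → Set
Disjoint k L = All (λ i → k i ≡ false) L

private
  variable
    k k′ m : Bin n

-ᵏ-congʳ : (d : Seq n) → k ≗ k′ → d -ᵏ k ≗ d -ᵏ k′
-ᵏ-congʳ d k≗k′ i = cong (λ b → d i ∸ bit b) (k≗k′ i)

insert-here : (k : Bin n) (x : Fin n) → insert x k x ≡ true
insert-here _ x = cong (_∨ _) (dec-true (x ≟ x) refl)

insert-there : (k : Bin n) {i x : Fin n} → i ≢ x → insert x k i ≡ k i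
insert-there _ {i} {x} i≢x = cong (_∨ _) (dec-false (i ≟ x) i≢x)

∪-insert : (m k : Bin n) {x : Fin n} → m ∪ insert x k ≗ insert x (m ∪ k)
∪-insert m k {x} i = ∨-swap (m i) (does (i ≟ x)) (k i)

insert-∪ : (m k : Bin n) {x : Fin n} → insert x (m ∪ k) ≗ insert x m ∪ k
insert-∪ m k {x} i = sym (Bool.∨-assoc (does (i ≟ x)) (m i) (k i))

indicator-∉ : {x : Fin n} {L : List (Fin n)} → x ∉ L → indicator L x ≡ false
indicator-∉ {x = x} {L} = dec-false (Any.any? (x ≟_) L)

indicator-support : (k : Bin n) → indicator (support k) ≗ k
indicator-support k i = does-⇔
  (mk⇔ (proj₂ ∘ ∈-filter⁻ (Bool.T? ∘ k) {xs = allFin _}) (∈-filter⁺ (Bool.T? ∘ k) (∈-allFin i)))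
  (Any.any? (i ≟_) (support k)) (Bool.T? (k i))

support-increasing : (k : Bin n) → Increasing (support k)
support-increasing k = AllPairs.filter⁺ (Bool.T? ∘ k) (AllPairs.tabulate⁺-< id)

disjoint-insert : {x : Fin n} {L : List (Fin n)} →
  All (x Fin.<_) L → Disjoint m L → Disjoint (insert x m) L
disjoint-insert {m = m} x<L m-L =
  All.zipWith (λ (x<i , mi) → trans (insert-there m (Fin.<⇒≢ x<i ∘ sym)) mi) (x<L , m-L)

graphic-shift : {d : Seq n} {c : Bin n} {a b : Fin n} → Arranged d → Positive d →
  a Fin.≤ b → c a ≡ false → c b ≡ false →
  Graphic (d -ᵏ insert b c) → Graphic (d -ᵏ insert a c)
graphic-shift {d = d} {c} {a} {b} arranged positive a≤b ca cb g with a ≟ b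
... | yes refl = g
... | no a≢b = graphic-transfer {u = a} {b} g shorter record
  { source = trans (cong suc after-a) (trans (suc-pred′ a) (sym before-a))
  ; target = trans after-b (trans (sym (suc-pred′ b)) (cong suc (sym before-b)))
  ; others = λ x x≢a x≢b →
      trans (at (insert a c) x (insert-there c x≢a)) (sym (at (insert b c) x (insert-there c x≢b)))
  }
  where
  at : ∀ {t} k x → k x ≡ t → (d -ᵏ k) x ≡ d x ∸ bit t
  at _ x = cong (λ t → d x ∸ bit t)
  suc-pred′ : ∀ x → suc (d x ∸ 1) ≡ d x
  suc-pred′ x = suc-pred (d x) {{>-nonZero (positive x)}}
  before-a : (d -ᵏ insert b c) a ≡ d a
  before-a = at (insert b c) a (trans (insert-there c a≢b) ca)
  before-b : (d -ᵏ insert b c) b ≡ d b ∸ 1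
  before-b = at (insert b c) b (insert-here c b)
  after-a : (d -ᵏ insert a c) a ≡ d a ∸ 1
  after-a = at (insert a c) a (insert-here c a)
  after-b : (d -ᵏ insert a c) b ≡ d b
  after-b = at (insert a c) b (trans (insert-there c (a≢b ∘ sym)) cb)
  shorter : (d -ᵏ insert b c) b < (d -ᵏ insert b c) a
  shorter = subst₂ _<_ (sym before-b) (sym before-a)
    (<-≤-trans (≤-reflexive (suc-pred′ b)) (arranged a b a≤b))

-- m records the positions a₁, …, aⱼ₋₁ already shifted into place.
graphic-⪯ : {d : Seq n} → Arranged d → Positive d → (m : Bin n) {as bs : List (Fin n)} →
  Increasing as → Increasing bs → as ⪯ bs → Disjoint m as → Disjoint m bs →
  Graphic (d -ᵏ (m ∪ indicator bs)) → Graphic (d -ᵏ (m ∪ indicator as))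
graphic-⪯ _ _ _ [] [] [] [] [] g = g
graphic-⪯ {d = d} arranged positive m {a ∷ as} {b ∷ bs}
  (a<as ∷ as↑) (b<bs ∷ bs↑) (a≤b ∷ as⪯bs) (ma ∷ m-as) (mb ∷ m-bs) g =
  graphic-resp (-ᵏ-congʳ d λ i →
      sym (trans (∪-insert m (indicator as) i) (insert-∪ m (indicator as) i)))
    (graphic-⪯ arranged positive (insert _ m) as↑ bs↑ as⪯bs
      (disjoint-insert a<as m-as) (disjoint-insert a<bs m-bs)
      (graphic-resp (-ᵏ-congʳ d (insert-∪ m (indicator bs)))
        (graphic-shift arranged positive a≤b
          (cong₂ _∨_ ma (indicator-∉ (All¬⇒¬Any (All.map Fin.<⇒≢ a<bs))))
          (cong₂ _∨_ mb (indicator-∉ (All¬⇒¬Any (All.map Fin.<⇒≢ b<bs))))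
          (graphic-resp (-ᵏ-congʳ d (∪-insert m (indicator bs))) g))))
  where
  a<bs : All (a Fin.<_) bs
  a<bs = All.map (≤-<-trans a≤b) b<bs

lemma2p6 : (n : ℕ) (d : Seq n) (k k′ : Bin n) →
    Arranged d → Positive d →
    Graphic (d -ᵏ k) → support k′ ⪯ support k →
    Graphic (d -ᵏ k′)
lemma2p6 _ d k k′ arranged positive g k′⪯k =
  graphic-resp (-ᵏ-congʳ d (indicator-support k′))
    (graphic-⪯ arranged positive (λ _ → false) (support-increasing k′) (support-increasing k) k′⪯k
      (All.universal (λ _ → refl) _) (All.universal (λ _ → refl) _)
      (graphic-resp (-ᵏ-congʳ d (sym ∘ indicator-support k)) g))
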